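{- Let $F=\mathbb{Q}(\sqrt{D})$ be a real quadratic field of discriminant $D>0$, with $\omega=(1+\sqrt{D})/2$ if $D\equiv1\pmod4$ and $\omega=\sqrt{D}/2$ if $D\equiv0\pmod4$ (so $\mathfrak{o}_F=\mathbb{Z}+\mathbb{Z}\omega$). Suppose there is a unit $u=\alpha+\beta\omega\in\mathfrak{o}_F$ with $N_{F/\mathbb{Q}}(u)=-1$ and $\alpha,\beta>0$. Let $\kappa\ge1$ be an integer. Then for every integer $n\ge0$, \[ \sum_{\substack{(a,b)\in\mathbb{Z}^2\\ a\beta-b\alpha=n}} r_{F,\kappa}(a+b\omega)=r_{2\kappa}(n). \]
   Context: For $\xi\in\mathfrak{o}_F$, $r_{F,k}(\xi)=\#\{(\xi_1,\dots,\xi_k)\in\mathfrak{o}_F^k:\ \xi_1^2+\cdots+\xi_k^2=\xi\}$, and for $n\in\mathbb{Z}$, $r_k(n)=\#\{(n_1,\dots,n_k)\in\mathbb{Z}^k:\ n_1^2+\cdots+n_k^2=n\}$. -}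

module Defs where

open import Data.Nat as ℕ using (ℕ; suc)
open import Data.Nat.DivMod using (_/_; _%_)
open import Data.Nat.Divisibility using (_∣_)
open import Data.Integer as ℤ using (ℤ; +_; _+_; _*_; _-_; -_)
open import Data.Product using (Σ; _×_; _,_)
open import Data.Sum using (_⊎_)
open import Data.Vec using (Vec; foldr)
open import Relation.Binary.PropositionalEquality using (_≡_; _≢_)

SquareFree : ℕ → Set
SquareFree m = ∀ (p : ℕ) → p ℕ.* p ∣ m → p ≡ 1

RealQuadDisc : ℕ → Set
RealQuadDisc D =
  (D % 4 ≡ 1 × SquareFree D × D ≢ 1)
  ⊎ Σ ℕ (λ m → D ≡ 4 ℕ.* m × (m % 4 ≡ 2 ⊎ m % 4 ≡ 3) × SquareFree m)

-- ω satisfies ω² = tr·ω + c with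
--   D ≡ 1 (mod 4): ω = (1+√D)/2, ω² = ω + (D-1)/4   (tr = 1, c = (D-1)/4 = ⌊D/4⌋)
--   D ≡ 0 (mod 4): ω = √D/2,     ω² = D/4          (tr = 0, c = D/4 = ⌊D/4⌋)
ωtr : ℕ → ℤ
ωtr D = + (D % 2)

ωc : ℕ → ℤ
ωc D = + (D / 4)

-- Ring of integers o_F = ℤ + ℤω; the pair (a , b) represents a + bω.
O : Set
O = ℤ × ℤ

oZero : O
oZero = (+ 0 , + 0)

oOne : O
oOne = (+ 1 , + 0)

oAdd : O → O → O
oAdd (a , b) (c , d) = (a + c , b + d)

-- (a + bω)(c + dω) = ac + bd·c₀ + (ad + bc + bd·tr) ω
oMul : ℕ → O → O → O
oMul D (a , b) (c , d) = (a * c + b * d * ωc D , a * d + b * c + b * d * ωtr D)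

-- N(a + bω) = (a + bω)(a + bω') with ω' = tr - ω, ωω' = -c₀
oNorm : ℕ → O → ℤ
oNorm D (a , b) = a * a + a * b * ωtr D - b * b * ωc D

IsUnit : ℕ → O → Set
IsUnit D u = Σ O (λ v → oMul D u v ≡ oOne)

oSumSq : ℕ → {k : ℕ} → Vec O k → O
oSumSq D = foldr _ (λ ξ acc → oAdd (oMul D ξ ξ) acc) oZero

zSumSq : {k : ℕ} → Vec ℤ k → ℤ
zSumSq = foldr _ (λ x acc → x * x + acc) (+ 0)

-- The set counted by Σ_{(a,b) : aβ - bα = n} r_{F,κ}(a + bω):
-- pairs (a,b) on the line together with a representation of a + bω as a sum of κ squares.
LHSSet : (D : ℕ) (α β : ℤ) (κ n : ℕ) → Set
LHSSet D α β κ n =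
  Σ (ℤ × ℤ) (λ ab → let a = Data.Product.proj₁ ab ; b = Data.Product.proj₂ ab in
    (a * β - b * α ≡ + n) × Σ (Vec O κ) (λ ξ → oSumSq D ξ ≡ (a , b)))

RSet : (k n : ℕ) → Set
RSet k n = Σ (Vec ℤ k) (λ x → zSumSq x ≡ + n)

{-# OPTIONS --safe #-}
-- The map a + bω ↦ aβ − bα is ℤ-linear, and on a square (x + yω)² it takes the value of the binary
-- form β x² − 2α xy + (c₀β − tr·α) y² (where ω² = tr·ω + c₀), whose determinant is −N(u) = 1.
-- A form A x² + 2b xy + C y² with A > 0 and AC − b² = 1 is integrally equivalent to x² + y²:
-- while b ≠ 0 the smaller of A, C is at most |b|, so a shear strictly decreases the larger one.
-- Applying this change of variables to each of the κ summands turns representations of points of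
-- the line into representations of n as a sum of 2κ squares, bijectively.
module Submission where

open import Data.Integer as ℤ using (ℤ; +_; -[1+_]; +[1+_]; _+_; _-_; _*_; -_; _<_)
import Data.Integer.Properties as ℤ
open import Data.Integer.Tactic.RingSolver using (solve-∀)
open import Data.Nat as ℕ using (ℕ; zero; suc; s≤s; z<s)
import Data.Nat.Properties as ℕ
open import Data.Nat.Induction using (<-rec)
import Data.Nat.Tactic.RingSolver as ℕ-Solver
open import Data.Product using (Σ; _×_; _,_; proj₁; proj₂; uncurry)
open import Data.Product.Algebra using (×-comm)
open import Data.Product.Function.Dependent.Propositional using (Σ-↔)
open import Data.Vec using (Vec; []; _∷_; _++_; map; foldr; take; drop; unzip)
open import Data.Vec.Properties using (×v↔v×; take++drop≡id; ++-injective; map-∘; map-cong; map-id)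
open import Function.Base using (_∘_)
open import Function.Bundles using (_↔_; Inverse; mk↔ₛ′)
open import Function.Properties.Inverse using (↔-refl; ↔-sym; ↔-trans)
open import Relation.Nullary using (contradiction; yes; no)
open import Relation.Binary.PropositionalEquality
open import Defs

open Inverse using (to; from; strictlyInverseˡ; strictlyInverseʳ)

n+n≡2*n : ∀ n → n ℕ.+ n ≡ 2 ℕ.* n
n+n≡2*n n = cong (n ℕ.+_) (sym (ℕ.+-identityʳ n))

∑ : {A : Set} {k : ℕ} → (A → ℤ) → Vec A k → ℤ
∑ f = foldr _ (λ x s → f x + s) (+ 0)

module _ {A : Set} where

  ∑-cong : ∀ {k} {f g : A → ℤ} → (∀ x → f x ≡ g x) → (v : Vec A k) → ∑ f v ≡ ∑ g v
  ∑-cong f≗g []      = refl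
  ∑-cong f≗g (x ∷ v) = cong₂ _+_ (f≗g x) (∑-cong f≗g v)

  ∑-map : ∀ {B : Set} {k} (f : B → ℤ) (g : A → B) (v : Vec A k) → ∑ f (map g v) ≡ ∑ (f ∘ g) v
  ∑-map f g []      = refl
  ∑-map f g (x ∷ v) = cong (_+_ (f (g x))) (∑-map f g v)

  ∑-++ : ∀ {m n} (f : A → ℤ) (xs : Vec A m) (ys : Vec A n) → ∑ f (xs ++ ys) ≡ ∑ f xs + ∑ f ys
  ∑-++ f []       ys = sym (ℤ.+-identityˡ (∑ f ys))
  ∑-++ f (x ∷ xs) ys = trans (cong (_+_ (f x)) (∑-++ f xs ys)) (sym (ℤ.+-assoc (f x) _ _))

  ∑-unzip : ∀ {k} (f : A → ℤ) (ps : Vec (A × A) k) →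
            ∑ f (proj₁ (unzip ps)) + ∑ f (proj₂ (unzip ps)) ≡ ∑ (λ p → f (proj₁ p) + f (proj₂ p)) ps
  ∑-unzip f []             = refl
  ∑-unzip f ((x , y) ∷ ps) =
    trans (interchange (f x) (∑ f (proj₁ (unzip ps))) (f y) (∑ f (proj₂ (unzip ps))))
          (cong (_+_ (f x + f y)) (∑-unzip f ps))
    where
    interchange : ∀ a b c d → a + b + (c + d) ≡ a + c + (b + d)
    interchange = solve-∀

  map-↔ : ∀ {B : Set} {k} → A ↔ B → Vec A k ↔ Vec B k
  map-↔ e = mk↔ₛ′ (map (to e)) (map (from e))
    (map-inverse (strictlyInverseˡ e)) (map-inverse (strictlyInverseʳ e))
    where
    map-inverse : ∀ {C D : Set} {k} {f : C → D} {g : D → C} →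
                  (∀ y → f (g y) ≡ y) → (v : Vec D k) → map f (map g v) ≡ v
    map-inverse {f = f} {g} fg v = trans (sym (map-∘ f g v)) (trans (map-cong fg v) (map-id v))

  ++-↔ : ∀ {m n} → (Vec A m × Vec A n) ↔ Vec A (m ℕ.+ n)
  ++-↔ {m} = mk↔ₛ′ (uncurry _++_) (λ v → take m v , drop m v) (take++drop≡id m) split-++
    where
    split-++ : ∀ {n} (p : Vec A m × Vec A n) → (take m (uncurry _++_ p) , drop m (uncurry _++_ p)) ≡ p
    split-++ (xs , ys) = uncurry (cong₂ _,_) (++-injective _ xs (take++drop≡id m (xs ++ ys)))

  length-↔ : ∀ {m n} → m ≡ n → Vec A m ↔ Vec A n
  length-↔ refl = ↔-refl

  ∑-length-↔ : ∀ {m n} (f : A → ℤ) (m≡n : m ≡ n) (v : Vec A m) → ∑ f (to (length-↔ m≡n) v) ≡ ∑ f v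
  ∑-length-↔ f refl v = refl

  flatten-↔ : ∀ {k} → Vec (A × A) k ↔ Vec A (2 ℕ.* k)
  flatten-↔ {k} = ↔-trans (↔-sym ×v↔v×) (↔-trans ++-↔ (length-↔ (n+n≡2*n k)))

  ∑-flatten : ∀ {k} (f : A → ℤ) (ps : Vec (A × A) k) →
              ∑ f (to flatten-↔ ps) ≡ ∑ (λ p → f (proj₁ p) + f (proj₂ p)) ps
  ∑-flatten {k} f ps = begin
    ∑ f (to flatten-↔ ps)       ≡⟨ ∑-length-↔ f (n+n≡2*n k) (xs ++ ys) ⟩
    ∑ f (xs ++ ys)              ≡⟨ ∑-++ f xs ys ⟩
    ∑ f xs + ∑ f ys             ≡⟨ ∑-unzip f ps ⟩
    ∑ (λ p → f (proj₁ p) + f (proj₂ p)) ps ∎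
    where
    open ≡-Reasoning
    xs = proj₁ (unzip ps)
    ys = proj₂ (unzip ps)

form : ℤ → ℤ → ℤ → ℤ × ℤ → ℤ
form A b C (x , y) = A * (x * x) + + 2 * b * (x * y) + C * (y * y)

normSq : ℤ × ℤ → ℤ
normSq (x , y) = x * x + y * y

Det≡1 : ℤ → ℤ → ℤ → Set
Det≡1 A b C = A * C ≡ + 1 + b * b

record SumOfSquaresForm (A b C : ℤ) : Set where
  field
    change : (ℤ × ℤ) ↔ (ℤ × ℤ)
    form≡normSq : ∀ p → form A b C p ≡ normSq (to change p)

open SumOfSquaresForm

sumOfSquaresForm-x²+y² : SumOfSquaresForm (+ 1) (+ 0) (+ 1)
sumOfSquaresForm-x²+y² = record { change = ↔-refl ; form≡normSq = λ (x , y) → form≡ x y }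
  where
  form≡ : ∀ x y → + 1 * (x * x) + + 2 * + 0 * (x * y) + + 1 * (y * y) ≡ x * x + y * y
  form≡ = solve-∀

sumOfSquaresForm-pullback : ∀ {A b C A′ b′ C′} (σ : (ℤ × ℤ) ↔ (ℤ × ℤ)) →
  (∀ p → form A b C (to σ p) ≡ form A′ b′ C′ p) →
  SumOfSquaresForm A′ b′ C′ → SumOfSquaresForm A b C
sumOfSquaresForm-pullback {A} {b} {C} {A′} {b′} {C′} σ σ-form S = record
  { change      = ↔-trans (↔-sym σ) (change S)
  ; form≡normSq = λ p → begin
      form A b C p                  ≡⟨ cong (form A b C) (strictlyInverseˡ σ p) ⟨
      form A b C (to σ (from σ p))  ≡⟨ σ-form (from σ p) ⟩
      form A′ b′ C′ (from σ p)      ≡⟨ form≡normSq S (from σ p) ⟩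
      normSq (to (change S) (from σ p)) ∎
  }
  where open ≡-Reasoning

sumOfSquaresForm-swap : ∀ {A b C} → SumOfSquaresForm C b A → SumOfSquaresForm A b C
sumOfSquaresForm-swap {A} {b} {C} =
  sumOfSquaresForm-pullback (×-comm ℤ ℤ) (λ (x , y) → swap-form A b C x y)
  where
  swap-form : ∀ A b C x y → A * (y * y) + + 2 * b * (y * x) + C * (x * x)
                          ≡ C * (x * x) + + 2 * b * (x * y) + A * (y * y)
  swap-form = solve-∀

reflect-↔ : (ℤ × ℤ) ↔ (ℤ × ℤ)
reflect-↔ = mk↔ₛ′ reflect reflect involutive involutive
  where
  reflect : ℤ × ℤ → ℤ × ℤ
  reflect (x , y) = (x , - y)
  involutive : ∀ p → reflect (reflect p) ≡ p
  involutive (x , y) = cong (x ,_) (ℤ.neg-involutive y)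

sumOfSquaresForm-reflect : ∀ {A b C} → SumOfSquaresForm A (- b) C → SumOfSquaresForm A b C
sumOfSquaresForm-reflect {A} {b} {C} =
  sumOfSquaresForm-pullback reflect-↔ (λ (x , y) → reflect-form A b C x y)
  where
  reflect-form : ∀ A b C x y → A * (x * x) + + 2 * b * (x * - y) + C * (- y * - y)
                             ≡ A * (x * x) + + 2 * (- b) * (x * y) + C * (y * y)
  reflect-form = solve-∀

shear-↔ : (ℤ × ℤ) ↔ (ℤ × ℤ)
shear-↔ = mk↔ₛ′ (λ (x , y) → (x - y , y)) (λ (x , y) → (x + y , y))
  (λ (x , y) → cong (_, y) (sub-add x y)) (λ (x , y) → cong (_, y) (add-sub x y))
  where
  sub-add : ∀ x y → x + y - y ≡ x
  sub-add = solve-∀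
  add-sub : ∀ x y → x - y + y ≡ x
  add-sub = solve-∀

sumOfSquaresForm-shear : ∀ {A b C} →
  SumOfSquaresForm A (b - A) (C - + 2 * b + A) → SumOfSquaresForm A b C
sumOfSquaresForm-shear {A} {b} {C} =
  sumOfSquaresForm-pullback shear-↔ (λ (x , y) → shear-form A b C x y)
  where
  shear-form : ∀ A b C x y → A * ((x - y) * (x - y)) + + 2 * b * ((x - y) * y) + C * (y * y)
                           ≡ A * (x * x) + + 2 * (b - A) * (x * y) + (C - + 2 * b + A) * (y * y)
  shear-form = solve-∀

shear-det : ∀ {A b C} → Det≡1 A b C → Det≡1 A (b - A) (C - + 2 * b + A)
shear-det {A} {b} {C} det = begin
  A * (C - + 2 * b + A)                   ≡⟨ expand A b C ⟩
  A * C - b * b + (b - A) * (b - A)       ≡⟨ cong (λ t → t - b * b + (b - A) * (b - A)) det ⟩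
  + 1 + b * b - b * b + (b - A) * (b - A) ≡⟨ cancel (b * b) ((b - A) * (b - A)) ⟩
  + 1 + (b - A) * (b - A)                 ∎
  where
  open ≡-Reasoning
  expand : ∀ A b C → A * (C - + 2 * b + A) ≡ A * C - b * b + (b - A) * (b - A)
  expand = solve-∀
  cancel : ∀ s t → + 1 + s - s + t ≡ + 1 + t
  cancel = solve-∀

square≡+ : ∀ b → Σ ℕ λ m → b * b ≡ + m
square≡+ (+ 0)     = 0 , refl
square≡+ +[1+ n ]  = _ , refl
square≡+ -[1+ n ]  = _ , refl

Det≡1⇒positive : ∀ {a C b} → Det≡1 (+ suc a) b C → Σ ℕ λ c → C ≡ + suc c
Det≡1⇒positive {C = +[1+ c ]} _ = c , refl
Det≡1⇒positive {a} {+ 0} {b} det with square≡+ b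
... | m , b²≡m =
  contradiction (trans (sym (ℤ.*-zeroʳ (+ suc a))) (trans det (cong (_+_ (+ 1)) b²≡m))) λ ()
Det≡1⇒positive {C = -[1+ c ]} {b} det with square≡+ b
... | m , b²≡m = contradiction (trans det (cong (_+_ (+ 1)) b²≡m)) λ ()

m≤n∧m*n≡1+[1+k]²⇒m≤1+k : ∀ {m n} k → m ℕ.≤ n → m ℕ.* n ≡ 1 ℕ.+ suc k ℕ.* suc k → m ℕ.≤ suc k
m≤n∧m*n≡1+[1+k]²⇒m≤1+k {m} {n} k m≤n m*n≡ = ℕ.≮⇒≥ λ 1+k<m → ℕ.<⇒≱ square< (begin
  suc (suc k) ℕ.* suc (suc k) ≤⟨ ℕ.*-mono-≤ 1+k<m 1+k<m ⟩
  m ℕ.* m                     ≤⟨ ℕ.*-monoʳ-≤ m m≤n ⟩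
  m ℕ.* n                     ≡⟨ m*n≡ ⟩
  1 ℕ.+ suc k ℕ.* suc k       ∎)
  where
  open ℕ.≤-Reasoning
  expand : ∀ k → 1 ℕ.+ suc k ℕ.* suc k ℕ.+ suc (suc (k ℕ.+ k)) ≡ suc (suc k) ℕ.* suc (suc k)
  expand = ℕ-Solver.solve-∀
  square< : 1 ℕ.+ suc k ℕ.* suc k ℕ.< suc (suc k) ℕ.* suc (suc k)
  square< = subst (1 ℕ.+ suc k ℕ.* suc k ℕ.<_) (expand k) (ℕ.m<m+n _ {suc (suc (k ℕ.+ k))} z<s)

c′+2[1+k]≡c+a⇒c′<c : ∀ {a c c′} k → a ℕ.≤ suc k → c′ ℕ.+ 2 ℕ.* suc k ≡ c ℕ.+ a → c′ ℕ.< c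
c′+2[1+k]≡c+a⇒c′<c {a} {c} {c′} k a≤1+k eq =
  ℕ.<-≤-trans (ℕ.m<m+n c′ z<s) (ℕ.+-cancelʳ-≤ (suc k) _ _ (begin
    c′ ℕ.+ suc k ℕ.+ suc k     ≡⟨ ℕ.+-assoc c′ (suc k) (suc k) ⟩
    c′ ℕ.+ (suc k ℕ.+ suc k)   ≡⟨ cong (c′ ℕ.+_) (n+n≡2*n (suc k)) ⟩
    c′ ℕ.+ 2 ℕ.* suc k         ≡⟨ eq ⟩
    c ℕ.+ a                    ≤⟨ ℕ.+-monoʳ-≤ c a≤1+k ⟩
    c ℕ.+ suc k                ∎))
  where open ℕ.≤-Reasoning

ReducesToSquares : ℕ → ℕ → Set
ReducesToSquares a c = ∀ b → Det≡1 (+ suc a) b (+ suc c) → SumOfSquaresForm (+ suc a) b (+ suc c)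

-- A ≤ C and AC = 1 + b² with b > 0 force A ≤ b, so the shear replaces C by C − 2b + A < C.
shear-step : ∀ {a c} → a ℕ.≤ c → (∀ {c′} → c′ ℕ.< c → ReducesToSquares a c′) →
             ∀ k → Det≡1 (+ suc a) +[1+ k ] (+ suc c) → SumOfSquaresForm (+ suc a) +[1+ k ] (+ suc c)
shear-step {a} {c} a≤c ih k det = reduce (Det≡1⇒positive {a} {C′} {b′} det′)
  where
  A = + suc a
  b′ = +[1+ k ] - A
  C′ = + suc c - + 2 * +[1+ k ] + A
  det′ : Det≡1 A b′ C′
  det′ = shear-det {A} {+[1+ k ]} {+ suc c} det
  rearrange : ∀ {A b C C′} → C - + 2 * b + A ≡ C′ → C′ + + 2 * b ≡ C + A
  rearrange {A} {b} {C} refl = cancel A b C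
    where
    cancel : ∀ A b C → C - + 2 * b + A + + 2 * b ≡ C + A
    cancel = solve-∀
  reduce : Σ ℕ (λ c′ → C′ ≡ + suc c′) → SumOfSquaresForm A +[1+ k ] (+ suc c)
  reduce (c′ , C′≡) = sumOfSquaresForm-shear
    (subst (SumOfSquaresForm A b′) (sym C′≡) (ih c′<c b′ (subst (Det≡1 A b′) C′≡ det′)))
    where
    c′<c : c′ ℕ.< c
    c′<c = ℕ.s<s⁻¹ (c′+2[1+k]≡c+a⇒c′<c k
             (m≤n∧m*n≡1+[1+k]²⇒m≤1+k k (s≤s a≤c) (ℤ.+-injective det))
             (ℤ.+-injective (rearrange {A} {+[1+ k ]} {+ suc c} C′≡)))

reduce-step : ∀ {a c} → a ℕ.≤ c → (∀ {c′} → c′ ℕ.< c → ReducesToSquares a c′) → ReducesToSquares a c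
reduce-step {zero}  {zero}  _ _ (+ 0) _ = sumOfSquaresForm-x²+y²
reduce-step {suc a} {c}     _ _ (+ 0) det =
  contradiction (ℕ.m*n≡1⇒m≡1 (suc (suc a)) (suc c) (ℤ.+-injective det)) λ ()
reduce-step {zero}  {suc c} _ _ (+ 0) det =
  contradiction (ℕ.m*n≡1⇒n≡1 1 (suc (suc c)) (ℤ.+-injective det)) λ ()
reduce-step a≤c ih +[1+ k ] det = shear-step a≤c ih k det
reduce-step a≤c ih -[1+ k ] det = sumOfSquaresForm-reflect (shear-step a≤c ih k det)

reducesToSquares : ∀ a c → ReducesToSquares a c
reducesToSquares a c = <-rec P reduce (a ℕ.+ c) a c refl
  where
  P : ℕ → Set
  P s = ∀ a c → a ℕ.+ c ≡ s → ReducesToSquares a c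
  reduce : ∀ s → (∀ {s′} → s′ ℕ.< s → P s′) → P s
  reduce _ rec a c refl with a ℕ.≤? c
  ... | yes a≤c = reduce-step a≤c (λ c′<c → rec (ℕ.+-monoʳ-< a c′<c) a _ refl)
  ... | no  a≰c = λ b det → sumOfSquaresForm-swap
          (reduce-step (ℕ.<⇒≤ (ℕ.≰⇒> a≰c)) swapped-ih b (trans (ℤ.*-comm (+ suc c) (+ suc a)) det))
    where
    swapped-ih : ∀ {a′} → a′ ℕ.< a → ReducesToSquares c a′
    swapped-ih {a′} a′<a b det = sumOfSquaresForm-swap
      (rec (ℕ.+-monoˡ-< c a′<a) a′ c refl b (trans (ℤ.*-comm (+ suc a′) (+ suc c)) det))

Det≡1⇒sumOfSquaresForm : ∀ {A b C} → + 0 < A → Det≡1 A b C → SumOfSquaresForm A b C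
Det≡1⇒sumOfSquaresForm {+ 0}      (ℤ.+<+ ())
Det≡1⇒sumOfSquaresForm {+[1+ a ]} {b} {C} _ det with Det≡1⇒positive {a} {C} {b} det
... | c , refl = reducesToSquares a c b det

wedge : O → O → ℤ
wedge (a , b) (α , β) = a * β - b * α

wedgeForm : ℕ → O → ℤ × ℤ → ℤ
wedgeForm D (α , β) = form β (- α) (ωc D * β - ωtr D * α)

wedge-oSumSq : ∀ D u {k} (ξs : Vec O k) → wedge (oSumSq D ξs) u ≡ ∑ (wedgeForm D u) ξs
wedge-oSumSq D (α , β) []             = zero-wedge α β
  where
  zero-wedge : ∀ α β → + 0 * β - + 0 * α ≡ + 0
  zero-wedge = solve-∀
wedge-oSumSq D (α , β) ((x , y) ∷ ξs) =
  trans (square-wedge x y (proj₁ (oSumSq D ξs)) (proj₂ (oSumSq D ξs)) α β (ωc D) (ωtr D))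
        (cong (_+_ (wedgeForm D (α , β) (x , y))) (wedge-oSumSq D (α , β) ξs))
  where
  square-wedge : ∀ x y a b α β c t →
    (x * x + y * y * c + a) * β - (x * y + y * x + y * y * t + b) * α
    ≡ β * (x * x) + + 2 * (- α) * (x * y) + (c * β - t * α) * (y * y) + (a * β - b * α)
  square-wedge = solve-∀

norm≡-1⇒Det≡1 : ∀ D α β → oNorm D (α , β) ≡ - (+ 1) → Det≡1 β (- α) (ωc D * β - ωtr D * α)
norm≡-1⇒Det≡1 D α β N≡-1 = trans (expand α β (ωtr D) (ωc D)) (cong (λ N → - N + - α * - α) N≡-1)
  where
  expand : ∀ α β t c → β * (c * β - t * α) ≡ - (α * α + α * β * t - β * β * c) + - α * - α
  expand = solve-∀

wedgeForm-sumOfSquares : ∀ D α β → oNorm D (α , β) ≡ - (+ 1) → + 0 < β →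
                         SumOfSquaresForm β (- α) (ωc D * β - ωtr D * α)
wedgeForm-sumOfSquares D α β N≡-1 0<β = Det≡1⇒sumOfSquaresForm 0<β (norm≡-1⇒Det≡1 D α β N≡-1)

fibre-↔ : ∀ {A B C : Set} (e : A ↔ B) {g : A → C} {h : B → C} → (∀ x → g x ≡ h (to e x)) →
          ∀ z → Σ A (λ x → g x ≡ z) ↔ Σ B (λ y → h y ≡ z)
fibre-↔ e {g} g≡h z = Σ-↔ e (λ {x} → subst (λ w → (g x ≡ z) ↔ (w ≡ z)) (g≡h x) ↔-refl)

LHSSet↔wedge-fibre : ∀ D α β κ n →
                     LHSSet D α β κ n ↔ Σ (Vec O κ) (λ ξs → wedge (oSumSq D ξs) (α , β) ≡ + n)
LHSSet↔wedge-fibre D α β κ n = mk↔ₛ′ forget remember (λ _ → refl) remember∘forget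
  where
  forget : LHSSet D α β κ n → Σ (Vec O κ) (λ ξs → wedge (oSumSq D ξs) (α , β) ≡ + n)
  forget (_ , onLine , ξs , refl) = ξs , onLine
  remember : Σ (Vec O κ) (λ ξs → wedge (oSumSq D ξs) (α , β) ≡ + n) → LHSSet D α β κ n
  remember (ξs , onLine) = oSumSq D ξs , onLine , ξs , refl
  remember∘forget : ∀ x → remember (forget x) ≡ x
  remember∘forget (_ , _ , _ , refl) = refl

proposition2p3 : (D : ℕ) → RealQuadDisc D →
    (α β : ℤ) → IsUnit D (α , β) → oNorm D (α , β) ≡ - (+ 1) → + 0 < α → + 0 < β →
    (κ : ℕ) → 1 ℕ.≤ κ → (n : ℕ) →
    LHSSet D α β κ n ↔ RSet (2 ℕ.* κ) n
proposition2p3 D _ α β _ N≡-1 _ 0<β κ _ n =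
  ↔-trans (LHSSet↔wedge-fibre D α β κ n)
          (fibre-↔ (↔-trans (map-↔ (change S)) flatten-↔) wedge≡sumSq (+ n))
  where
  S = wedgeForm-sumOfSquares D α β N≡-1 0<β
  open ≡-Reasoning
  wedge≡sumSq : ∀ ξs → wedge (oSumSq D ξs) (α , β) ≡ zSumSq (to flatten-↔ (map (to (change S)) ξs))
  wedge≡sumSq ξs = begin
    wedge (oSumSq D ξs) (α , β)       ≡⟨ wedge-oSumSq D (α , β) ξs ⟩
    ∑ (wedgeForm D (α , β)) ξs        ≡⟨ ∑-cong (form≡normSq S) ξs ⟩
    ∑ (normSq ∘ to (change S)) ξs     ≡⟨ ∑-map normSq (to (change S)) ξs ⟨
    ∑ normSq (map (to (change S)) ξs) ≡⟨ ∑-flatten (λ x → x * x) (map (to (change S)) ξs) ⟨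
    zSumSq (to flatten-↔ (map (to (change S)) ξs)) ∎
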